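{- Let $G$ be a triangulation of the projective plane. If $G$ contains an odd hole one of whose vertices has degree $4$ in $G$, then $G$ contains a loose odd wheel.
   Context: A triangulation of the projective plane is a finite simple graph embedded in the projective plane such that every face is bounded by a $3$-cycle. An odd hole is an induced odd cycle on at least $4$ (hence at least $5$) vertices. For a cycle $C$ and $v_1,v_2,v_3\in V(C)$, $C[v_1,v_2]_{v_3}$ is the path along $C$ from $v_1$ to $v_2$ avoiding $v_3$. For an odd cycle $C$ and $v\notin V(C)$, three neighbours $v_1,v_2,v_3$ of $v$ on $C$ are three odd neighbours if $C[v_1,v_2]_{v_3}$, $C[v_1,v_3]_{v_2}$, $C[v_2,v_3]_{v_1}$ are all odd. A loose odd wheel consists of an odd cycle $C$ and a vertex $v\notin V(C)$ with three odd neighbours on $C$. -}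

module Defs where

open import Data.Bool using (Bool; true; false; _∧_; _∨_; if_then_else_)
open import Data.Nat using (ℕ; zero; suc; _+_; _∸_; _≤_; _<_; _<ᵇ_)
open import Data.Nat.DivMod using (_%_; _mod_)
open import Data.Fin using (Fin; toℕ; _≟_)
open import Data.List using (List; length; filterᵇ; allFin; concatMap; map)
open import Data.List.Membership.Propositional using (_∈_)
open import Data.List.Relation.Unary.Any using (Any)
open import Data.List.Relation.Unary.Unique.Propositional using (Unique)
open import Data.Product using (Σ; ∃; _×_; _,_)
open import Data.Sum using (_⊎_)
open import Relation.Binary.PropositionalEquality using (_≡_; _≢_)
open import Relation.Binary.Construct.Closure.ReflexiveTransitive using (Star)
open import Relation.Nullary.Decidable using (⌊_⌋)
open import Function.Definitions using (Injective)

record Graph (n : ℕ) : Set where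
  field
    adj     : Fin n → Fin n → Bool
    adj-sym : ∀ u v → adj u v ≡ adj v u
    adj-irr : ∀ v → adj v v ≡ false

module _ {n : ℕ} (G : Graph n) where
  open Graph G

  Adj : Fin n → Fin n → Set
  Adj u v = adj u v ≡ true

  degree : Fin n → ℕ
  degree v = length (filterᵇ (adj v) (allFin n))

  pairs : List (Fin n × Fin n)
  pairs = concatMap (λ i → map (λ j → (i , j)) (filterᵇ (λ j → toℕ i <ᵇ toℕ j) (allFin n))) (allFin n)

  edgeCount : ℕ
  edgeCount = length (filterᵇ (λ p → adj (Data.Product.proj₁ p) (Data.Product.proj₂ p)) pairs)

  Connected : Set
  Connected = ∀ u w → Star Adj u w

-- Faces are stored as ordered triples (a , b , c) with a < b < c.

Face : ℕ → Set
Face n = Fin n × Fin n × Fin n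

inFace : {n : ℕ} → Fin n → Face n → Bool
inFace v (a , b , c) = ⌊ v ≟ a ⌋ ∨ ⌊ v ≟ b ⌋ ∨ ⌊ v ≟ c ⌋

-- Triangulation of the projective plane, described combinatorially as a
-- connected closed combinatorial surface (each edge in exactly two
-- triangular faces, every vertex link is connected) of Euler
-- characteristic 1.
record ProjTriangulation (n : ℕ) : Set where
  field
    graph : Graph n
    faces : List (Face n)
  open Graph graph
  field
    faces-sorted : ∀ {a b c} → (a , b , c) ∈ faces → toℕ a < toℕ b × toℕ b < toℕ c
    faces-unique : Unique faces
    faces-tri    : ∀ {a b c} → (a , b , c) ∈ faces →
                   Adj graph a b × Adj graph b c × Adj graph a c
    edge-in-two  : ∀ u v → Adj graph u v →
                   length (filterᵇ (λ f → inFace u f ∧ inFace v f) faces) ≡ 2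
    no-isolated  : ∀ v → ∃ λ u → Adj graph v u
    connected    : Connected graph
    -- link of v: neighbours u, w adjacent iff {v,u,w} is a face
    link-connected : ∀ v u w → Adj graph v u → Adj graph v w →
                     Star (λ x y → x ≢ v × y ≢ v × x ≢ y ×
                                   Any (λ f → inFace v f ≡ true × inFace x f ≡ true × inFace y f ≡ true) faces)
                          u w
    euler        : n + length faces ≡ 1 + edgeCount graph

-- Cycles, indexed by positions Fin (suc k) (length suc k)

next : {k : ℕ} → Fin (suc k) → Fin (suc k)
next {k} i = suc (toℕ i) mod (suc k)

Odd : ℕ → Set
Odd m = m % 2 ≡ 1

module _ {n : ℕ} (G : Graph n) where

  IsCycle : {k : ℕ} → (Fin (suc k) → Fin n) → Set
  IsCycle {k} C = 2 ≤ k × Injective _≡_ _≡_ C × (∀ i → Adj G (C i) (C (next i)))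

  IsOddCycle : {k : ℕ} → (Fin (suc k) → Fin n) → Set
  IsOddCycle {k} C = IsCycle C × Odd (suc k)

  IsOddHole : {k : ℕ} → (Fin (suc k) → Fin n) → Set
  IsOddHole {k} C = IsOddCycle C × 4 ≤ k ×
                    (∀ i j → Adj G (C i) (C j) → j ≡ next i ⊎ i ≡ next j)

-- forward distance from position p to q along a cycle of length m
fwd : ℕ → ℕ → ℕ → ℕ
fwd m p q = (q + m ∸ p) % suc (m ∸ 1)

-- length of the path C[p,q]_r along a cycle of length m
arcLen : ℕ → ℕ → ℕ → ℕ → ℕ
arcLen m p q r = if fwd m p r <ᵇ fwd m p q then fwd m q p else fwd m p q

module _ {n : ℕ} (G : Graph n) where

  ThreeOddNeighbours : {k : ℕ} → (Fin (suc k) → Fin n) → Fin n →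
                       Fin (suc k) → Fin (suc k) → Fin (suc k) → Set
  ThreeOddNeighbours {k} C v a b c =
    a ≢ b × a ≢ c × b ≢ c ×
    Adj G v (C a) × Adj G v (C b) × Adj G v (C c) ×
    Odd (arcLen (suc k) (toℕ a) (toℕ b) (toℕ c)) ×
    Odd (arcLen (suc k) (toℕ a) (toℕ c) (toℕ b)) ×
    Odd (arcLen (suc k) (toℕ b) (toℕ c) (toℕ a))

  HasLooseOddWheel : Set
  HasLooseOddWheel =
    Σ ℕ λ k → Σ (Fin (suc k) → Fin n) λ C → Σ (Fin n) λ v →
      IsOddCycle G C × (∀ i → C i ≢ v) ×
      Σ (Fin (suc k)) λ a → Σ (Fin (suc k)) λ b → Σ (Fin (suc k)) λ c →
        ThreeOddNeighbours C v a b c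

  HasOddHoleWithDegree4Vertex : Set
  HasOddHoleWithDegree4Vertex =
    Σ ℕ λ k → Σ (Fin (suc k) → Fin n) λ C →
      IsOddHole G C × Σ (Fin (suc k)) λ i → degree G (C i) ≡ 4

module Submission where

-- Let C be an odd hole of a projective-plane triangulation and u = C i a
-- vertex of degree 4, with hole-neighbours a = C (i-1) and b = C (i+1).
-- The edge ua lies on two faces, whose third corners t₁ ≠ t₂ are common
-- neighbours of u and a; the edge ub gives a common neighbour t of u and b.
-- As C is induced, a and b are non-adjacent, so a, b, t₁, t₂ are four
-- distinct neighbours of u and hence all of them; thus t ∈ {t₁, t₂} is a
-- vertex z adjacent to a, u and b.  Being adjacent to two consecutive hole
-- vertices, z is off C, and a, u, b are three odd neighbours of z on C
-- (arcs of lengths 1, 1 and |C| - 2).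

open import Defs
open import Data.Bool using (Bool; true; _∧_; if_then_else_)
open import Data.Bool.Properties using (T-≡; T-∧)
open import Data.Empty using (⊥-elim)
open import Data.Fin as Fin using (Fin; zero; suc; toℕ; _≟_)
import Data.Fin.Properties as Finₚ
open import Data.List using (List; []; _∷_; length; lookup; filterᵇ; allFin)
open import Data.List.Membership.Propositional using (_∈_; _∉_; find; lose)
open import Data.List.Membership.Propositional.Properties using (∈-lookup; ∈-filter⁺; ∈-filter⁻; ∈-allFin)
open import Data.List.Membership.Setoid.Properties using (index-injective)
import Data.List.Membership.DecPropositional as DecMembership
open import Data.List.Relation.Binary.Subset.Propositional using (_⊆_)
open import Data.List.Relation.Unary.All as All using (All; []; _∷_)
open import Data.List.Relation.Unary.All.Properties using (¬Any⇒All¬)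
open import Data.List.Relation.Unary.Any as Any using (here; there; any?)
open import Data.List.Relation.Unary.AllPairs using ([]; _∷_)
open import Data.List.Relation.Unary.Unique.Propositional using (Unique)
import Data.List.Relation.Unary.Unique.Propositional.Properties as Uniqueₚ
open import Data.Nat as ℕ using (ℕ; suc; _+_; _*_; _%_; s≤s; z≤n)
import Data.Nat.Properties as ℕₚ
open import Data.Nat.DivMod using (%-distribˡ-+; m%n%n≡m%n; [m+n]%n≡m%n; [m+kn]%n≡m%n; m<n⇒m%n≡m; m%n<n; _mod_)
open import Data.Product using (∃; ∃₂; _×_; _,_)
open import Data.Sum using (_⊎_; inj₁; inj₂)
open import Function using (_∘_)
open import Function.Bundles using (Equivalence)
open import Relation.Binary.Definitions using (DecidableEquality)
open import Relation.Binary.PropositionalEquality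
open import Relation.Nullary using (¬_; yes; no; ¬?)
open import Relation.Nullary.Decidable using (T?; decidable-stable)

module _ {A : Set} where

  unique-lookup : {ys : List A} → Unique ys → {i j : Fin (length ys)} →
                  i Fin.< j → lookup ys i ≢ lookup ys j
  unique-lookup (y∉ys ∷ _)    {zero}  {suc j} _          = All.lookup y∉ys (∈-lookup j)
  unique-lookup (_ ∷ ys-uniq) {suc i} {suc j} (s≤s i<j)  = unique-lookup ys-uniq i<j

  unique-⊆⇒length≤ : {xs ys : List A} → Unique ys → ys ⊆ xs → length ys ℕ.≤ length xs
  unique-⊆⇒length≤ {xs} {ys} ys-uniq ys⊆xs with length xs ℕ.<? length ys
  ... | no ≮ = ℕₚ.≮⇒≥ ≮
  ... | yes longer
    with i , j , i<j , same-index ← Finₚ.pigeonhole longer (λ i → Any.index (ys⊆xs (∈-lookup i)))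
    = ⊥-elim (unique-lookup ys-uniq i<j
               (index-injective (setoid A) (ys⊆xs (∈-lookup i)) (ys⊆xs (∈-lookup j)) same-index))

module _ {A : Set} (_≟ᴬ_ : DecidableEquality A) where
  open DecMembership _≟ᴬ_ using (_∈?_)

  unique-⊆-exhausts : {xs ys : List A} → Unique ys → ys ⊆ xs →
                      length xs ℕ.≤ length ys → xs ⊆ ys
  unique-⊆-exhausts {xs} {ys} ys-uniq ys⊆xs short {v} v∈xs with v ∈? ys
  ... | yes v∈ys = v∈ys
  ... | no v∉ys = ⊥-elim (ℕₚ.<⇒≱ (unique-⊆⇒length≤ (¬Any⇒All¬ ys v∉ys ∷ ys-uniq) v∷ys⊆xs) short)
    where
    v∷ys⊆xs : v ∷ ys ⊆ xs
    v∷ys⊆xs (here refl) = v∈xs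
    v∷ys⊆xs (there w∈ys) = ys⊆xs w∈ys

  unique-outside : {xs ys : List A} → Unique xs → length ys ℕ.< length xs →
                   ∃ λ x → x ∈ xs × x ∉ ys
  unique-outside {xs} {ys} xs-uniq longer with any? (λ x → ¬? (x ∈? ys)) xs
  ... | yes outside = find outside
  ... | no ¬outside = ⊥-elim (ℕₚ.<⇒≱ longer (unique-⊆⇒length≤ xs-uniq xs⊆ys))
    where
    xs⊆ys : xs ⊆ ys
    xs⊆ys {x} x∈xs = decidable-stable (x ∈? ys) (¬outside ∘ lose x∈xs)

two-distinct : {A : Set} (xs : List A) → length xs ≡ 2 → Unique xs →
               ∃₂ λ x y → x ≢ y × x ∈ xs × y ∈ xs
two-distinct (x ∷ y ∷ []) refl ((x≢y ∷ []) ∷ _) = x , y , x≢y , here refl , there (here refl)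

vertices : {n : ℕ} → Face n → List (Fin n)
vertices (x , y , w) = x ∷ y ∷ w ∷ []

inFace⇒∈ : {n : ℕ} (v : Fin n) (f : Face n) → inFace v f ≡ true → v ∈ vertices f
inFace⇒∈ v (x , y , w) v∈f with v ≟ x | v ≟ y | v ≟ w
... | yes v≡x | _       | _       = here v≡x
... | no _    | yes v≡y | _       = there (here v≡y)
... | no _    | no _    | yes v≡w = there (there (here v≡w))

Sorted : {n : ℕ} → Face n → Set
Sorted (x , y , w) = x Fin.< y × y Fin.< w

sorted⇒unique : {n : ℕ} {f : Face n} → Sorted f → Unique (vertices f)
sorted⇒unique (x<y , y<w) =
  (Finₚ.<⇒≢ x<y ∷ Finₚ.<⇒≢ (ℕₚ.<-trans x<y y<w) ∷ []) ∷ (Finₚ.<⇒≢ y<w ∷ []) ∷ [] ∷ []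

first-least : {n : ℕ} {x y w v : Fin n} → Sorted (x , y , w) → v ∈ vertices (x , y , w) → x Fin.≤ v
first-least _           (here refl)                 = ℕₚ.≤-refl
first-least (x<y , _)   (there (here refl))         = ℕₚ.<⇒≤ x<y
first-least (x<y , y<w) (there (there (here refl))) = ℕₚ.<⇒≤ (ℕₚ.<-trans x<y y<w)

last-largest : {n : ℕ} {x y w v : Fin n} → Sorted (x , y , w) → v ∈ vertices (x , y , w) → v Fin.≤ w
last-largest (x<y , y<w) (here refl)                 = ℕₚ.<⇒≤ (ℕₚ.<-trans x<y y<w)
last-largest (_ , y<w)   (there (here refl))         = ℕₚ.<⇒≤ y<w
last-largest _           (there (there (here refl))) = ℕₚ.≤-refl

sorted-face-ext : {n : ℕ} {f₁ f₂ : Face n} → Sorted f₁ → Sorted f₂ →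
                  vertices f₁ ⊆ vertices f₂ → vertices f₂ ⊆ vertices f₁ → f₁ ≡ f₂
sorted-face-ext {f₁ = x₁ , y₁ , w₁} {x₂ , y₂ , w₂} s₁@(x₁<y₁ , y₁<w₁) s₂ f₁⊆f₂ f₂⊆f₁ =
  cong₂ _,_ x₁≡x₂ (cong₂ _,_ (middle (f₁⊆f₂ (there (here refl)))) w₁≡w₂)
  where
  x₁≡x₂ : x₁ ≡ x₂
  x₁≡x₂ = Finₚ.≤-antisym (first-least s₁ (f₂⊆f₁ (here refl))) (first-least s₂ (f₁⊆f₂ (here refl)))
  w₁≡w₂ : w₁ ≡ w₂
  w₁≡w₂ = Finₚ.≤-antisym (last-largest s₂ (f₁⊆f₂ (there (there (here refl)))))
                         (last-largest s₁ (f₂⊆f₁ (there (there (here refl)))))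
  middle : y₁ ∈ vertices (x₂ , y₂ , w₂) → y₁ ≡ y₂
  middle (here y₁≡x₂)                 = ⊥-elim (Finₚ.<⇒≢ x₁<y₁ (trans x₁≡x₂ (sym y₁≡x₂)))
  middle (there (here y₁≡y₂))         = y₁≡y₂
  middle (there (there (here y₁≡w₂))) = ⊥-elim (Finₚ.<⇒≢ y₁<w₁ (trans y₁≡w₂ (sym w₁≡w₂)))

module _ {n : ℕ} (G : Graph n) where
  open Graph G

  adj-symm : {u v : Fin n} → Adj G u v → Adj G v u
  adj-symm {u} {v} uv = trans (adj-sym v u) uv

  adj⇒≢ : {u v : Fin n} → Adj G u v → u ≢ v
  adj⇒≢ {u} uu refl with () ← trans (sym (adj-irr u)) uu

  neighbours : Fin n → List (Fin n)
  neighbours u = filterᵇ (adj u) (allFin n)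

  adj⇒∈neighbours : {u v : Fin n} → Adj G u v → v ∈ neighbours u
  adj⇒∈neighbours {u} {v} uv = ∈-filter⁺ (T? ∘ adj u) (∈-allFin v) (Equivalence.from T-≡ uv)

  degree-4-neighbourhood : {u p q r s v : Fin n} → degree G u ≡ 4 →
    Unique (p ∷ q ∷ r ∷ s ∷ []) → All (Adj G u) (p ∷ q ∷ r ∷ s ∷ []) →
    Adj G u v → v ∈ p ∷ q ∷ r ∷ s ∷ []
  degree-4-neighbourhood deg pqrs-uniq pqrs-adj uv =
    unique-⊆-exhausts _≟_ pqrs-uniq (adj⇒∈neighbours ∘ All.lookup pqrs-adj)
                      (ℕₚ.≤-reflexive deg) (adj⇒∈neighbours uv)

module _ {n : ℕ} (T : ProjTriangulation n) where
  open ProjTriangulation T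

  FaceOn : Fin n → Fin n → Face n → Set
  FaceOn u a f = f ∈ faces × u ∈ vertices f × a ∈ vertices f

  face-adj : {f : Face n} {p q : Fin n} → f ∈ faces →
             p ∈ vertices f → q ∈ vertices f → p ≢ q → Adj graph p q
  face-adj f∈ p∈ q∈ p≢q with faces-tri f∈
  face-adj _ (here refl)                 (here refl)                 p≢q | _ = ⊥-elim (p≢q refl)
  face-adj _ (here refl)                 (there (here refl))         _   | xy , _  , _  = xy
  face-adj _ (here refl)                 (there (there (here refl))) _   | _  , _  , xw = xw
  face-adj _ (there (here refl))         (here refl)                 _   | xy , _  , _  = adj-symm graph xy
  face-adj _ (there (here refl))         (there (here refl))         p≢q | _ = ⊥-elim (p≢q refl)
  face-adj _ (there (here refl))         (there (there (here refl))) _   | _  , yw , _  = yw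
  face-adj _ (there (there (here refl))) (here refl)                 _   | _  , _  , xw = adj-symm graph xw
  face-adj _ (there (there (here refl))) (there (here refl))         _   | _  , yw , _  = adj-symm graph yw
  face-adj _ (there (there (here refl))) (there (there (here refl))) p≢q | _ = ⊥-elim (p≢q refl)

  incident : Fin n → Fin n → Face n → Bool
  incident u a f = inFace u f ∧ inFace a f

  facesOn : Fin n → Fin n → List (Face n)
  facesOn u a = filterᵇ (incident u a) faces

  facesOn-sound : {u a : Fin n} {f : Face n} → f ∈ facesOn u a → FaceOn u a f
  facesOn-sound {u} {a} {f} f∈
    with f∈faces , on ← ∈-filter⁻ (T? ∘ incident u a) f∈
    with u∈f , a∈f ← Equivalence.to T-∧ on
    = f∈faces , inFace⇒∈ u f (Equivalence.to T-≡ u∈f) , inFace⇒∈ a f (Equivalence.to T-≡ a∈f)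

  two-faces-on-edge : {u a : Fin n} → Adj graph u a →
                      ∃₂ λ f₁ f₂ → f₁ ≢ f₂ × FaceOn u a f₁ × FaceOn u a f₂
  two-faces-on-edge {u} {a} ua
    with f₁ , f₂ , f₁≢f₂ , f₁∈ , f₂∈ ← two-distinct (facesOn u a) (edge-in-two u a ua)
           (Uniqueₚ.filter⁺ (T? ∘ incident u a) faces-unique)
    = f₁ , f₂ , f₁≢f₂ , facesOn-sound f₁∈ , facesOn-sound f₂∈

  apex : {u a : Fin n} {f : Face n} → FaceOn u a f →
         ∃ λ t → t ∈ vertices f × t ∉ u ∷ a ∷ []
  apex (f∈ , _) = unique-outside _≟_ (sorted⇒unique (faces-sorted f∈)) (s≤s (s≤s (s≤s z≤n)))

  faces-through-triangle : {u a t : Fin n} {f₁ f₂ : Face n} → Unique (u ∷ a ∷ t ∷ []) →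
    FaceOn u a f₁ → t ∈ vertices f₁ → FaceOn u a f₂ → t ∈ vertices f₂ → f₁ ≡ f₂
  faces-through-triangle {u} {a} {t} uat-uniq on₁@(f₁∈ , _) t∈f₁ on₂@(f₂∈ , _) t∈f₂ =
    sorted-face-ext (faces-sorted f₁∈) (faces-sorted f₂∈)
      (triangle⊆ on₂ t∈f₂ ∘ exhausted on₁ t∈f₁) (triangle⊆ on₁ t∈f₁ ∘ exhausted on₂ t∈f₂)
    where
    triangle⊆ : {f : Face n} → FaceOn u a f → t ∈ vertices f → u ∷ a ∷ t ∷ [] ⊆ vertices f
    triangle⊆ (_ , u∈ , _) _ (here refl) = u∈
    triangle⊆ (_ , _ , a∈) _ (there (here refl)) = a∈
    triangle⊆ _ t∈ (there (there (here refl))) = t∈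
    exhausted : {f : Face n} → FaceOn u a f → t ∈ vertices f → vertices f ⊆ u ∷ a ∷ t ∷ []
    exhausted on t∈ = unique-⊆-exhausts _≟_ uat-uniq (triangle⊆ on t∈) ℕₚ.≤-refl

  two-common-neighbours : {u a : Fin n} → Adj graph u a →
    ∃₂ λ t₁ t₂ → t₁ ≢ t₂ × (Adj graph u t₁ × Adj graph a t₁) × (Adj graph u t₂ × Adj graph a t₂)
  two-common-neighbours {u} {a} ua
    with f₁ , f₂ , f₁≢f₂ , on₁ , on₂ ← two-faces-on-edge ua
    with t₁ , t₁∈f₁ , t₁∉ua ← apex on₁
       | t₂ , t₂∈f₂ , t₂∉ua ← apex on₂
    = t₁ , t₂ , t₁≢t₂ , corner-adj on₁ t₁∈f₁ t₁∉ua , corner-adj on₂ t₂∈f₂ t₂∉ua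
    where
    corner-adj : {f : Face n} {t : Fin n} → FaceOn u a f → t ∈ vertices f → t ∉ u ∷ a ∷ [] →
                 Adj graph u t × Adj graph a t
    corner-adj (f∈ , u∈ , a∈) t∈ t∉ua =
      face-adj f∈ u∈ t∈ (λ u≡t → t∉ua (here (sym u≡t))) ,
      face-adj f∈ a∈ t∈ (λ a≡t → t∉ua (there (here (sym a≡t))))
    t₁≢t₂ : t₁ ≢ t₂
    t₁≢t₂ refl = f₁≢f₂ (faces-through-triangle uat-uniq on₁ t₁∈f₁ on₂ t₂∈f₂)
      where
      uat-uniq : Unique (u ∷ a ∷ t₁ ∷ [])
      uat-uniq = (adj⇒≢ graph ua ∷ (λ u≡t → t₁∉ua (here (sym u≡t))) ∷ [])
               ∷ ((λ a≡t → t₁∉ua (there (here (sym a≡t)))) ∷ []) ∷ [] ∷ []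

  -- Two distinct non-adjacent neighbours a, b of a degree-4 vertex u have a
  -- common neighbour adjacent to u: the two apexes on ua, together with a
  -- and b, are all neighbours of u, so an apex on ub is one of them.
  degree-4-common-neighbour : {u a b : Fin n} → degree graph u ≡ 4 →
    Adj graph u a → Adj graph u b → ¬ Adj graph a b → a ≢ b →
    ∃ λ z → Adj graph u z × Adj graph a z × Adj graph b z
  degree-4-common-neighbour {u} {a} {b} deg ua ub ¬ab a≢b
    with t₁ , t₂ , t₁≢t₂ , (ut₁ , at₁) , (ut₂ , at₂) ← two-common-neighbours ua
       | t , _ , _ , (ut , bt) , _ ← two-common-neighbours ub
    = pick (degree-4-neighbourhood graph deg link-unique link-adj ut)
    where
    link-unique : Unique (a ∷ b ∷ t₁ ∷ t₂ ∷ [])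
    link-unique = (a≢b ∷ adj⇒≢ graph at₁ ∷ adj⇒≢ graph at₂ ∷ [])
                ∷ ((λ { refl → ¬ab at₁ }) ∷ (λ { refl → ¬ab at₂ }) ∷ [])
                ∷ (t₁≢t₂ ∷ []) ∷ [] ∷ []
    link-adj : All (Adj graph u) (a ∷ b ∷ t₁ ∷ t₂ ∷ [])
    link-adj = ua ∷ ub ∷ ut₁ ∷ ut₂ ∷ []
    pick : t ∈ a ∷ b ∷ t₁ ∷ t₂ ∷ [] → ∃ λ z → Adj graph u z × Adj graph a z × Adj graph b z
    pick (here refl)                         = ⊥-elim (¬ab (adj-symm graph bt))
    pick (there (here refl))                 = ⊥-elim (adj⇒≢ graph bt refl)
    pick (there (there (here refl)))         = t₁ , ut₁ , at₁ , bt
    pick (there (there (there (here refl)))) = t₂ , ut₂ , at₂ , bt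

%-absorbˡ : ∀ a b d .{{_ : ℕ.NonZero d}} → (a % d + b) % d ≡ (a + b) % d
%-absorbˡ a b d = begin
  (a % d + b) % d           ≡⟨ %-distribˡ-+ (a % d) b d ⟩
  (a % d % d + b % d) % d   ≡⟨ cong (λ r → (r + b % d) % d) (m%n%n≡m%n a d) ⟩
  (a % d + b % d) % d       ≡⟨ %-distribˡ-+ a b d ⟨
  (a + b) % d               ∎
  where open ≡-Reasoning

%-absorbʳ : ∀ a b d .{{_ : ℕ.NonZero d}} → (a + b % d) % d ≡ (a + b) % d
%-absorbʳ a b d = begin
  (a + b % d) % d   ≡⟨ cong (_% d) (ℕₚ.+-comm a (b % d)) ⟩
  (b % d + a) % d   ≡⟨ %-absorbˡ b a d ⟩
  (b + a) % d       ≡⟨ cong (_% d) (ℕₚ.+-comm b a) ⟩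
  (a + b) % d       ∎
  where open ≡-Reasoning

module _ {k : ℕ} where

  rotate : ℕ → Fin (suc k) → Fin (suc k)
  rotate s j = (toℕ j + s) mod suc k

  toℕ-rotate : (s : ℕ) (j : Fin (suc k)) → toℕ (rotate s j) ≡ (toℕ j + s) % suc k
  toℕ-rotate s j = Finₚ.toℕ-fromℕ< (m%n<n (toℕ j + s) (suc k))

  toℕ-next : (j : Fin (suc k)) → toℕ (next j) ≡ suc (toℕ j) % suc k
  toℕ-next j = Finₚ.toℕ-fromℕ< (m%n<n (suc (toℕ j)) (suc k))

  rotate-next : (s : ℕ) (j : Fin (suc k)) → rotate s (next j) ≡ next (rotate s j)
  rotate-next s j = Finₚ.toℕ-injective (begin
    toℕ (rotate s (next j))             ≡⟨ toℕ-rotate s (next j) ⟩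
    (toℕ (next j) + s) % suc k          ≡⟨ cong (λ r → (r + s) % suc k) (toℕ-next j) ⟩
    (suc (toℕ j) % suc k + s) % suc k   ≡⟨ %-absorbˡ (suc (toℕ j)) s (suc k) ⟩
    suc (toℕ j + s) % suc k             ≡⟨ %-absorbʳ 1 (toℕ j + s) (suc k) ⟨
    suc ((toℕ j + s) % suc k) % suc k   ≡⟨ cong (λ r → suc r % suc k) (toℕ-rotate s j) ⟨
    suc (toℕ (rotate s j)) % suc k      ≡⟨ toℕ-next (rotate s j) ⟨
    toℕ (next (rotate s j))             ∎)
    where open ≡-Reasoning

  -- Rotating by s and then by k * s is a full number of turns.
  rotate-inverse : (s : ℕ) (j : Fin (suc k)) → rotate (k * s) (rotate s j) ≡ j
  rotate-inverse s j = Finₚ.toℕ-injective (begin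
    toℕ (rotate (k * s) (rotate s j))        ≡⟨ toℕ-rotate (k * s) (rotate s j) ⟩
    (toℕ (rotate s j) + k * s) % suc k       ≡⟨ cong (λ r → (r + k * s) % suc k) (toℕ-rotate s j) ⟩
    ((toℕ j + s) % suc k + k * s) % suc k    ≡⟨ %-absorbˡ (toℕ j + s) (k * s) (suc k) ⟩
    (toℕ j + s + k * s) % suc k              ≡⟨ cong (_% suc k) full-turns ⟩
    (toℕ j + s * suc k) % suc k              ≡⟨ [m+kn]%n≡m%n (toℕ j) s (suc k) ⟩
    toℕ j % suc k                            ≡⟨ m<n⇒m%n≡m (Finₚ.toℕ<n j) ⟩
    toℕ j                                    ∎)
    where
    open ≡-Reasoning
    full-turns : toℕ j + s + k * s ≡ toℕ j + s * suc k
    full-turns = begin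
      toℕ j + s + k * s     ≡⟨ ℕₚ.+-assoc (toℕ j) s (k * s) ⟩
      toℕ j + (s + k * s)   ≡⟨ cong (λ r → toℕ j + (s + r)) (ℕₚ.*-comm k s) ⟩
      toℕ j + (s + s * k)   ≡⟨ cong (toℕ j +_) (ℕₚ.*-suc s k) ⟨
      toℕ j + s * suc k     ∎

  rotate-injective : (s : ℕ) {i j : Fin (suc k)} → rotate s i ≡ rotate s j → i ≡ j
  rotate-injective s {i} {j} same = begin
    i                              ≡⟨ rotate-inverse s i ⟨
    rotate (k * s) (rotate s i)    ≡⟨ cong (rotate (k * s)) same ⟩
    rotate (k * s) (rotate s j)    ≡⟨ rotate-inverse s j ⟩
    j                              ∎
    where open ≡-Reasoning

rotate-to-1 : {k : ℕ} (i : Fin (suc (suc k))) → rotate (toℕ i + suc k) (suc zero) ≡ i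
rotate-to-1 {k} i = Finₚ.toℕ-injective (begin
  toℕ (rotate (toℕ i + suc k) (suc zero))   ≡⟨ toℕ-rotate (toℕ i + suc k) (suc zero) ⟩
  suc (toℕ i + suc k) % suc (suc k)         ≡⟨ cong (_% suc (suc k)) (ℕₚ.+-suc (toℕ i) (suc k)) ⟨
  (toℕ i + suc (suc k)) % suc (suc k)       ≡⟨ [m+n]%n≡m%n (toℕ i) (suc (suc k)) ⟩
  toℕ i % suc (suc k)                       ≡⟨ m<n⇒m%n≡m (Finₚ.toℕ<n i) ⟩
  toℕ i                                     ∎)
  where open ≡-Reasoning

rotate-odd-hole : {n k : ℕ} (G : Graph n) {C : Fin (suc k) → Fin n} (s : ℕ) →
                  IsOddHole G C → IsOddHole G (C ∘ rotate s)
rotate-odd-hole G {C} s (((2≤k , C-inj , C-adj) , odd-length) , 4≤k , induced) =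
  ((2≤k , rotate-injective s ∘ C-inj , rotated-adj) , odd-length) , 4≤k , rotated-induced
  where
  rotated-adj : ∀ j → Adj G (C (rotate s j)) (C (rotate s (next j)))
  rotated-adj j = subst (λ p → Adj G (C (rotate s j)) (C p)) (sym (rotate-next s j)) (C-adj (rotate s j))
  rotated-induced : ∀ i j → Adj G (C (rotate s i)) (C (rotate s j)) → j ≡ next i ⊎ i ≡ next j
  rotated-induced i j ij with induced (rotate s i) (rotate s j) ij
  ... | inj₁ j-after-i = inj₁ (rotate-injective s (trans j-after-i (sym (rotate-next s i))))
  ... | inj₂ i-after-j = inj₂ (rotate-injective s (trans i-after-j (sym (rotate-next s j))))

arcLen-unfold : ∀ m p q r {x y} → fwd m p r ≡ x → fwd m p q ≡ y →
                arcLen m p q r ≡ (if x ℕ.<ᵇ y then fwd m q p else y)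
arcLen-unfold m p q r refl refl = refl

arcs-0-1-2 : (k : ℕ) → let m = 5 + k in Odd m →
             Odd (arcLen m 0 1 2) × Odd (arcLen m 0 2 1) × Odd (arcLen m 1 2 0)
arcs-0-1-2 k odd-m =
  subst Odd (sym (arcLen-unfold m 0 1 2 fwd-0-2 fwd-0-1)) refl ,
  subst Odd (sym (trans (arcLen-unfold m 0 2 1 fwd-0-1 fwd-0-2) fwd-2-0)) odd-m∸2 ,
  subst Odd (sym (arcLen-unfold m 1 2 0 fwd-1-0 fwd-1-2)) refl
  where
  m : ℕ
  m = 5 + k
  fwd-0-1 : fwd m 0 1 ≡ 1
  fwd-0-1 = [m+n]%n≡m%n 1 m
  fwd-0-2 : fwd m 0 2 ≡ 2
  fwd-0-2 = [m+n]%n≡m%n 2 m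
  fwd-1-2 : fwd m 1 2 ≡ 1
  fwd-1-2 = [m+n]%n≡m%n 1 m
  fwd-1-0 : fwd m 1 0 ≡ 4 + k
  fwd-1-0 = m<n⇒m%n≡m ℕₚ.≤-refl
  fwd-2-0 : fwd m 2 0 ≡ 3 + k
  fwd-2-0 = m<n⇒m%n≡m (ℕₚ.n≤1+n (4 + k))
  odd-m∸2 : Odd (3 + k)
  odd-m∸2 = trans (sym ([m+n]%n≡m%n (3 + k) 2)) (trans (cong (_% 2) (ℕₚ.+-comm (3 + k) 2)) odd-m)

module _ {n : ℕ} (T : ProjTriangulation n) where
  open ProjTriangulation T

  -- If position 1 of an odd hole D has degree 4, the common neighbour z of
  -- D 0, D 1, D 2 lies off D and has them as three odd neighbours.
  wheel-at-1 : {k : ℕ} (D : Fin (5 + k) → Fin n) → IsOddHole graph D →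
               degree graph (D (suc zero)) ≡ 4 → HasLooseOddWheel graph
  wheel-at-1 {k} D (odd-cycle@((_ , D-inj , D-adj) , odd-length) , _ , induced) deg =
    wheel (degree-4-common-neighbour T deg (adj-symm graph (D-adj zero)) (D-adj (suc zero)) ¬adj-0-2 0≢2)
    where
    -- D is induced and longer than 3, so D 0 and D 2 are distinct and non-adjacent.
    ¬adj-0-2 : ¬ Adj graph (D zero) (D (suc (suc zero)))
    ¬adj-0-2 adj with induced zero (suc (suc zero)) adj
    ... | inj₁ ()
    ... | inj₂ ()
    0≢2 : D zero ≢ D (suc (suc zero))
    0≢2 same with () ← D-inj same
    -- A vertex D j adjacent to D 1 and D 0 sits next to both positions, so it
    -- is D 2 or D 1; neither is adjacent to z itself.
    off-cycle : {z : Fin n} → Adj graph (D (suc zero)) z → Adj graph (D zero) z →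
                Adj graph (D (suc (suc zero))) z → ∀ j → D j ≢ z
    off-cycle {z} uz az bz j refl
      with induced (suc zero) j uz | induced zero j az
    ... | inj₁ refl | _         = adj⇒≢ graph bz refl
    ... | inj₂ _    | inj₁ refl = adj⇒≢ graph uz refl
    ... | inj₂ 1≡j+1 | inj₂ 0≡j+1 with () ← trans 1≡j+1 (sym 0≡j+1)
    wheel : (∃ λ z → Adj graph (D (suc zero)) z × Adj graph (D zero) z × Adj graph (D (suc (suc zero))) z) →
            HasLooseOddWheel graph
    wheel (z , uz , az , bz) =
      4 + k , D , z , odd-cycle , off-cycle uz az bz , zero , suc zero , suc (suc zero) ,
      (λ ()) , (λ ()) , (λ ()) , adj-symm graph az , adj-symm graph uz , adj-symm graph bz ,
      arcs-0-1-2 k odd-length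

mainTheorem6 : (n : ℕ) (T : ProjTriangulation n) →
    HasOddHoleWithDegree4Vertex (ProjTriangulation.graph T) →
    HasLooseOddWheel (ProjTriangulation.graph T)
mainTheorem6 n T (suc (suc (suc (suc k))) , C , hole@(_ , s≤s (s≤s (s≤s (s≤s _))) , _) , i , deg) =
  wheel-at-1 T (C ∘ rotate s) (rotate-odd-hole (ProjTriangulation.graph T) s hole)
    (subst (λ p → degree (ProjTriangulation.graph T) (C p) ≡ 4) (sym (rotate-to-1 i)) deg)
  where
  -- rotating by s moves the degree-4 vertex C i to position 1
  s : ℕ
  s = toℕ i + suc (suc (suc (suc k)))
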